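{- For every $k\ge 1$, the number of $x\in\{0,1\}^{3^k}$ with $\mathrm{NAE}^k(x)=0$ equals $2^{3^k}\left(\frac13 \pm o_k(1)\right)$, and the number of $x\in\{0,1\}^{3^k}$ with $\mathrm{NAE}^k(x)=1$ equals $2^{3^k}\left(\frac23 \pm o_k(1)\right)$, where $o_k(1)\to 0$ as $k\to\infty$.
   Context: $\mathrm{NAE}:\{0,1\}^3\to\{0,1\}$ is $0$ if all three inputs are equal and $1$ otherwise. $\mathrm{NAE}^1 = \mathrm{NAE}$, and for $k>1$, $\mathrm{NAE}^k:\{0,1\}^{3^k}\to\{0,1\}$ is defined by $\mathrm{NAE}^k(x) = \mathrm{NAE}\big(\mathrm{NAE}^{k-1}(x_1,\dots,x_{3^{k-1}}),\ \mathrm{NAE}^{k-1}(x_{3^{k-1}+1},\dots,x_{2\cdot 3^{k-1}}),\ \mathrm{NAE}^{k-1}(x_{2\cdot 3^{k-1}+1},\dots,x_{3^k})\big)$. (These sets are the vertex sets of the graphs $G_k^{(0)}$ and $G_k^{(1)}$ given by the principal minors of $A_k=\mathrm{NAE}^k\circ\mathrm{AND}^{3^k}$ with diagonal $0$, resp. $1$.) -}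

module Defs where

open import Data.Bool using (Bool; true; false; _∧_; not)
open import Data.Nat using (ℕ; zero; suc; _^_)
open import Data.Nat.Properties using (m^n≢0)
open import Data.Vec using (Vec; []; _∷_; splitAt)
open import Data.Product using (_,_)
open import Data.List using (List; []; _∷_; map; _++_; length; filter)
open import Relation.Nullary.Decidable using (Dec)
open import Data.Bool.Properties using () renaming (_≟_ to _≟ᵇ_)
open import Relation.Binary.PropositionalEquality using (_≡_)
open import Data.Integer using (+_)
open import Data.Rational using (ℚ; _/_)

NAE : Bool → Bool → Bool → Bool
NAE true  true  true  = false
NAE false false false = false
NAE _     _     _     = true

-- NAE^(suc k) : {0,1}^(3^(suc k)) → {0,1}, i.e. NAEk k is the paper's NAE^(k+1).
-- 3 ^ suc (suc k) reduces to n + (n + (n + 0)) with n = 3 ^ suc k,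
-- so the input splits into its three consecutive thirds.
NAEk : (k : ℕ) → Vec Bool (3 ^ suc k) → Bool
NAEk zero (a ∷ b ∷ c ∷ []) = NAE a b c
NAEk (suc k) v with splitAt (3 ^ suc k) v
... | x , rest , _ with splitAt (3 ^ suc k) rest
...   | y , z' , _ with splitAt (3 ^ suc k) z'
...     | z , _ , _ = NAE (NAEk k x) (NAEk k y) (NAEk k z)

allVecs : (n : ℕ) → List (Vec Bool n)
allVecs zero = [] ∷ []
allVecs (suc n) = map (false ∷_) (allVecs n) ++ map (true ∷_) (allVecs n)

count : (k : ℕ) → Bool → ℕ
count k b = length (filter (λ x → NAEk k x ≟ᵇ b) (allVecs (3 ^ suc k)))

density : (k : ℕ) → Bool → ℚ
density k b = (+ count k b) / (2 ^ 3 ^ suc k)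
  where instance _ = m^n≢0 2 (3 ^ suc k)

{-# OPTIONS --safe #-}
module Submission where

-- Splitting x ∈ {0,1}^(3^(k+2)) into thirds, NAE^(k+2)(x) = 0 iff the three values of NAE^(k+1)
-- agree, so the density p_k of zeros satisfies p_{k+1} = p_k³ + (1 − p_k)³; equivalently
-- e_k = p_k − 1/3 satisfies e_{k+1} = F(e_k) with F(x) = 3x² − x.  Since F′(0) = −1, the
-- convergence e_k → 0 is only of order k^(−1/2); it is controlled by the Lyapunov function
-- W(x) = 2x²(1 − 3x) = −2x F(x).  On the F-invariant interval [−1/12, 5/48] = [e_0, e_1] one has
-- x² ≤ W(x) and W(F x) ≤ W(x) − W(x)², so 1/W(e_k) grows by at least 1 per step, and
-- W(e_0) = 5/288 ≤ 1/50 gives e_k² ≤ W(e_k) ≤ 1/(k + 50).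

open import Defs
open import Data.Bool using (Bool; true; false)
open import Data.Nat using (ℕ; suc)
open import Data.Product using (Σ; _×_)
open import Data.Integer using (+_)
open import Data.Rational using (ℚ; _/_; _-_; ∣_∣; _≤_; _<_; 0ℚ)

open import Data.Bool.Properties using () renaming (_≟_ to _≟ᵇ_)
open import Data.Product using (_,_; proj₁; proj₂)
open import Function using (_∘_)
open import Level using (Level; 0ℓ)
open import Relation.Binary.PropositionalEquality

module Counting where
  open import Data.Nat using (zero; _+_; _*_; _^_)
  open import Data.Nat.Properties using (+-identityʳ; *-identityˡ; *-zeroʳ)
  open import Data.Nat.ListAction using (sum)
  open import Data.Nat.ListAction.Properties using (sum-++)
  import Data.Nat.Tactic.RingSolver as ℕ-Solver
  open import Data.List using (List; []; _∷_; map; length; filter) renaming (_++_ to _++ᴸ_)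
  open import Data.List.Properties using (map-++; map-∘; map-cong)
  open import Data.Vec using (Vec; []; _∷_; _++_; splitAt)
  open import Relation.Nullary using (does)
  open import Relation.Unary using (Pred; Decidable)
  open ≡-Reasoning

  private
    variable
      a p : Level
      A : Set a

  𝟙 : Bool → ℕ
  𝟙 true  = 1
  𝟙 false = 0

  length-filter : {P : Pred A p} (P? : Decidable P) (xs : List A) →
                  length (filter P? xs) ≡ sum (map (𝟙 ∘ does ∘ P?) xs)
  length-filter P? []       = refl
  length-filter P? (x ∷ xs) with does (P? x)
  ... | true  = cong suc (length-filter P? xs)
  ... | false = length-filter P? xs

  ∑𝔹 : (Bool → ℕ) → ℕ
  ∑𝔹 h = h false + h true

  preimage-size : (A → Bool) → List A → Bool → ℕ
  preimage-size f xs b = sum (map (λ x → 𝟙 (does (f x ≟ᵇ b))) xs)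

  sum-map-fibres : (f : A → Bool) (h : Bool → ℕ) (xs : List A) →
                   sum (map (h ∘ f) xs) ≡ ∑𝔹 (λ b → h b * preimage-size f xs b)
  sum-map-fibres f h [] = sym (cong₂ _+_ (*-zeroʳ (h false)) (*-zeroʳ (h true)))
  sum-map-fibres f h (x ∷ xs) with f x | sum-map-fibres f h xs
  ... | false | ih = trans (cong (_+_ (h false)) ih) (arith (h false) (h true) _ _)
    where
    arith : ∀ a b s t → a + (a * s + b * t) ≡ a * (1 + s) + b * t
    arith = ℕ-Solver.solve-∀
  ... | true  | ih = trans (cong (_+_ (h true)) ih) (arith (h false) (h true) _ _)
    where
    arith : ∀ a b s t → b + (a * s + b * t) ≡ a * s + b * (1 + t)
    arith = ℕ-Solver.solve-∀

  ∑ : (n : ℕ) → (Vec Bool n → ℕ) → ℕ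
  ∑ n g = sum (map g (allVecs n))

  ∑-cong : ∀ {n} {g h : Vec Bool n → ℕ} → (∀ x → g x ≡ h x) → ∑ n g ≡ ∑ n h
  ∑-cong {n} g≗h = cong sum (map-cong g≗h (allVecs n))

  ∑-suc : ∀ n (g : Vec Bool (suc n) → ℕ) → ∑ (suc n) g ≡ ∑ n (g ∘ (false ∷_)) + ∑ n (g ∘ (true ∷_))
  ∑-suc n g = begin
    sum (map g (map (false ∷_) xs ++ᴸ map (true ∷_) xs))       ≡⟨ cong sum (map-++ g (map (false ∷_) xs) _) ⟩
    sum (map g (map (false ∷_) xs) ++ᴸ map g (map (true ∷_) xs)) ≡⟨ sum-++ (map g (map (false ∷_) xs)) _ ⟩
    sum (map g (map (false ∷_) xs)) + sum (map g (map (true ∷_) xs))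
      ≡⟨ sym (cong₂ (λ u v → sum u + sum v) (map-∘ xs) (map-∘ xs)) ⟩
    ∑ n (g ∘ (false ∷_)) + ∑ n (g ∘ (true ∷_)) ∎
    where
    xs : List (Vec Bool n)
    xs = allVecs n

  ∑-++ : ∀ m {n} (g : Vec Bool (m + n) → ℕ) → ∑ (m + n) g ≡ ∑ m (λ x → ∑ n (λ y → g (x ++ y)))
  ∑-++ zero    {n} g = sym (+-identityʳ (∑ n g))
  ∑-++ (suc m) {n} g = begin
    ∑ (suc m + n) g                                           ≡⟨ ∑-suc (m + n) g ⟩
    ∑ (m + n) (g ∘ (false ∷_)) + ∑ (m + n) (g ∘ (true ∷_))    ≡⟨ cong₂ _+_ (∑-++ m (g ∘ (false ∷_))) (∑-++ m (g ∘ (true ∷_))) ⟩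
    ∑ m (λ x → ∑ n (λ y → g (false ∷ x ++ y))) + ∑ m (λ x → ∑ n (λ y → g (true ∷ x ++ y)))
                                                              ≡⟨ sym (∑-suc m (λ x → ∑ n (λ y → g (x ++ y)))) ⟩
    ∑ (suc m) (λ x → ∑ n (λ y → g (x ++ y)))                  ∎

  ∑-thirds : ∀ m (g : Vec Bool (3 * m) → ℕ) →
             ∑ (3 * m) g ≡ ∑ m (λ x → ∑ m (λ y → ∑ m (λ z → g (x ++ y ++ z ++ []))))
  ∑-thirds m g = begin
    ∑ (3 * m) g                                             ≡⟨ ∑-++ m {2 * m} g ⟩
    ∑ m (λ x → ∑ (2 * m) (λ w → g (x ++ w)))                ≡⟨ ∑-cong {m} (λ x → ∑-++ m {m + 0} (λ w → g (x ++ w))) ⟩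
    ∑ m (λ x → ∑ m (λ y → ∑ (m + 0) (λ w → g (x ++ y ++ w)))) ≡⟨ ∑-cong {m} (λ x → ∑-cong {m} (λ y → ∑-++ m {0} (λ w → g (x ++ y ++ w)))) ⟩
    ∑ m (λ x → ∑ m (λ y → ∑ m (λ z → g (x ++ y ++ z ++ []) + 0))) ≡⟨ ∑-cong {m} (λ x → ∑-cong {m} (λ y → ∑-cong {m} (λ z → +-identityʳ _))) ⟩
    ∑ m (λ x → ∑ m (λ y → ∑ m (λ z → g (x ++ y ++ z ++ [])))) ∎

  ∑-1 : ∀ n → ∑ n (λ _ → 1) ≡ 2 ^ n
  ∑-1 zero    = refl
  ∑-1 (suc n) = begin
    ∑ (suc n) (λ _ → 1)              ≡⟨ ∑-suc n (λ _ → 1) ⟩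
    ∑ n (λ _ → 1) + ∑ n (λ _ → 1)    ≡⟨ cong₂ _+_ (∑-1 n) (∑-1 n) ⟩
    2 ^ n + 2 ^ n                    ≡⟨ cong (_+_ (2 ^ n)) (sym (+-identityʳ (2 ^ n))) ⟩
    2 ^ suc n                        ∎

  preimage-size-total : ∀ {n} (f : Vec Bool n → Bool) →
                        preimage-size f (allVecs n) false + preimage-size f (allVecs n) true ≡ 2 ^ n
  preimage-size-total {n} f = begin
    # false + # true             ≡⟨ sym (cong₂ _+_ (*-identityˡ (# false)) (*-identityˡ (# true))) ⟩
    1 * # false + 1 * # true     ≡⟨ sym (sum-map-fibres f (λ _ → 1) (allVecs n)) ⟩
    ∑ n (λ _ → 1)                ≡⟨ ∑-1 n ⟩
    2 ^ n                        ∎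
    where
    # : Bool → ℕ
    # = preimage-size f (allVecs n)

  ∑³-fibres : ∀ {n} (f : Vec Bool n → Bool) (g : Bool → Bool → Bool → ℕ) →
              let # = preimage-size f (allVecs n) in
              ∑ n (λ x → ∑ n (λ y → ∑ n (λ z → g (f x) (f y) (f z))))
                ≡ ∑𝔹 (λ a → ∑𝔹 (λ b → ∑𝔹 (λ c → g a b c * # c) * # b) * # a)
  ∑³-fibres {n} f g = begin
    ∑ n (λ x → ∑ n (λ y → ∑ n (λ z → g (f x) (f y) (f z))))
      ≡⟨ ∑-cong (λ x → ∑-cong (λ y → sum-map-fibres f (g (f x) (f y)) xs)) ⟩
    ∑ n (λ x → ∑ n (λ y → ∑𝔹 (λ c → g (f x) (f y) c * # c)))
      ≡⟨ ∑-cong (λ x → sum-map-fibres f (λ b → ∑𝔹 (λ c → g (f x) b c * # c)) xs) ⟩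
    ∑ n (λ x → ∑𝔹 (λ b → ∑𝔹 (λ c → g (f x) b c * # c) * # b))
      ≡⟨ sum-map-fibres f (λ a → ∑𝔹 (λ b → ∑𝔹 (λ c → g a b c * # c) * # b)) xs ⟩
    ∑𝔹 (λ a → ∑𝔹 (λ b → ∑𝔹 (λ c → g a b c * # c) * # b) * # a) ∎
    where
    xs : List (Vec Bool n)
    xs = allVecs n
    # : Bool → ℕ
    # = preimage-size f xs

  splitAt-++ : ∀ m {n} (xs : Vec A m) (ys : Vec A n) → splitAt m (xs ++ ys) ≡ (xs , ys , refl)
  splitAt-++ zero    []       ys = refl
  splitAt-++ (suc m) (x ∷ xs) ys rewrite splitAt-++ m xs ys = refl

  NAEk-++ : ∀ k (x y z : Vec Bool (3 ^ suc k)) →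
            NAEk (suc k) (x ++ y ++ z ++ []) ≡ NAE (NAEk k x) (NAEk k y) (NAEk k z)
  NAEk-++ k x y z
    rewrite splitAt-++ (3 ^ suc k) x (y ++ z ++ [])
          | splitAt-++ (3 ^ suc k) y (z ++ [])
          | splitAt-++ (3 ^ suc k) z [] = refl

  count-preimage : ∀ k b → count k b ≡ preimage-size (NAEk k) (allVecs (3 ^ suc k)) b
  count-preimage k b = length-filter (λ x → NAEk k x ≟ᵇ b) (allVecs (3 ^ suc k))

  count-false+count-true : ∀ k → count k false + count k true ≡ 2 ^ 3 ^ suc k
  count-false+count-true k = begin
    count k false + count k true   ≡⟨ cong₂ _+_ (count-preimage k false) (count-preimage k true) ⟩
    # false + # true               ≡⟨ preimage-size-total (NAEk k) ⟩
    2 ^ 3 ^ suc k                  ∎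
    where
    # : Bool → ℕ
    # = preimage-size (NAEk k) (allVecs (3 ^ suc k))

  count-suc : ∀ k → let a = count k false; b = count k true in
              count (suc k) false ≡ a * a * a + b * b * b
  count-suc k = begin
    count (suc k) false
      ≡⟨ count-preimage (suc k) false ⟩
    ∑ (3 * m) (λ v → 𝟙 (does (NAEk (suc k) v ≟ᵇ false)))
      ≡⟨ ∑-thirds m _ ⟩
    ∑ m (λ x → ∑ m (λ y → ∑ m (λ z → 𝟙 (does (NAEk (suc k) (x ++ y ++ z ++ []) ≟ᵇ false)))))
      ≡⟨ ∑-cong (λ x → ∑-cong (λ y → ∑-cong (λ z → cong (λ t → 𝟙 (does (t ≟ᵇ false))) (NAEk-++ k x y z)))) ⟩
    ∑ m (λ x → ∑ m (λ y → ∑ m (λ z → 𝟙 (does (NAE (NAEk k x) (NAEk k y) (NAEk k z) ≟ᵇ false)))))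
      ≡⟨ ∑³-fibres (NAEk k) (λ a b c → 𝟙 (does (NAE a b c ≟ᵇ false))) ⟩
    ∑𝔹 (λ a → ∑𝔹 (λ b → ∑𝔹 (λ c → 𝟙 (does (NAE a b c ≟ᵇ false)) * # c) * # b) * # a)
      ≡⟨ arith (# false) (# true) ⟩
    # false * # false * # false + # true * # true * # true
      ≡⟨ sym (cong₂ (λ a b → a * a * a + b * b * b) (count-preimage k false) (count-preimage k true)) ⟩
    count k false * count k false * count k false + count k true * count k true * count k true ∎
    where
    m : ℕ
    m = 3 ^ suc k
    # : Bool → ℕ
    # = preimage-size (NAEk k) (allVecs m)
    -- only the constant triples (false, false, false) and (true, true, true) have NAE value false
    arith : ∀ a b → ((1 * a + 0 * b) * a + (0 * a + 0 * b) * b) * a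
                      + ((0 * a + 0 * b) * a + (0 * a + 1 * b) * b) * b ≡ a * a * a + b * b * b
    arith = ℕ-Solver.solve-∀

open Counting using (count-false+count-true; count-suc)

import Data.Nat as ℕ
import Data.Nat.Properties as ℕ
import Data.Integer as ℤ
import Data.Integer.Properties as ℤ
import Data.Integer.Tactic.RingSolver as ℤ-Solver
open import Data.Rational
open import Data.Rational.Properties
open import Data.Rational.Literals using (fromℤ)
import Data.Rational.Unnormalised as ℚᵘ
import Data.Rational.Unnormalised.Properties as ℚᵘ
open import Data.Empty using (⊥-elim)
open import Data.Sum using (inj₁; inj₂)
open import Relation.Nullary using (yes; no; contradiction)
open import Relation.Nullary.Decidable using (dec⇒maybe; from-yes)
import Relation.Binary.Reasoning.Setoid as SetoidReasoning
open import Tactic.RingSolver using (solve-∀)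
open import Tactic.RingSolver.Core.AlmostCommutativeRing using (AlmostCommutativeRing; fromCommutativeRing)

ℚ-ring : AlmostCommutativeRing 0ℓ 0ℓ
ℚ-ring = fromCommutativeRing +-*-commutativeRing (λ p → dec⇒maybe (0ℚ ≟ p))

ι : ℕ → ℚ
ι n = fromℤ (+ n)

ι-+ : ∀ a b → ι (a ℕ.+ b) ≡ ι a + ι b
ι-+ a b = toℚᵘ-injective (ℚᵘ.≃-trans (ℚᵘ.*≡* eq) (ℚᵘ.≃-sym (toℚᵘ-homo-+ (ι a) (ι b))))
  where
  eq : + (a ℕ.+ b) ℤ.* + 1 ≡ (+ a ℤ.* + 1 ℤ.+ + b ℤ.* + 1) ℤ.* + 1
  eq = trans (cong (ℤ._* + 1) (ℤ.pos-+ a b)) (arith (+ a) (+ b))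
    where
    arith : ∀ i j → (i ℤ.+ j) ℤ.* + 1 ≡ (i ℤ.* + 1 ℤ.+ j ℤ.* + 1) ℤ.* + 1
    arith = ℤ-Solver.solve-∀

ι-suc : ∀ n → ι (suc n) ≡ 1ℚ + ι n
ι-suc = ι-+ 1

ι-* : ∀ a b → ι (a ℕ.* b) ≡ ι a * ι b
ι-* a b = toℚᵘ-injective (ℚᵘ.≃-trans (ℚᵘ.≃-reflexive (cong (λ i → ℚᵘ.mkℚᵘ i 0) (ℤ.pos-* a b)))
                                     (ℚᵘ.≃-sym (toℚᵘ-homo-* (ι a) (ι b))))

ι-mono-≤ : ∀ {a b} → a ℕ.≤ b → ι a ≤ ι b
ι-mono-≤ a≤b = *≤* (ℤ.*-monoʳ-≤-nonNeg (+ 1) (ℤ.+≤+ a≤b))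

0≤ι : ∀ n → 0ℚ ≤ ι n
0≤ι n = ι-mono-≤ ℕ.z≤n

toℚᵘ-/ : ∀ i n .{{_ : ℕ.NonZero n}} → toℚᵘ (i / n) ℚᵘ.≃ (i ℚᵘ./ n)
toℚᵘ-/ i (suc n) = toℚᵘ-fromℚᵘ (ℚᵘ.mkℚᵘ i n)

/-+ : ∀ i j n .{{_ : ℕ.NonZero n}} → (i ℤ.+ j) / n ≡ i / n + j / n
/-+ i j n@(suc _) = toℚᵘ-injective (begin
  toℚᵘ ((i ℤ.+ j) / n)                 ≈⟨ toℚᵘ-/ (i ℤ.+ j) n ⟩
  (i ℤ.+ j) ℚᵘ./ n                     ≈⟨ ℚᵘ.*≡* eq ⟩
  i ℚᵘ./ n ℚᵘ.+ j ℚᵘ./ n               ≈⟨ ℚᵘ.≃-sym (ℚᵘ.+-cong (toℚᵘ-/ i n) (toℚᵘ-/ j n)) ⟩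
  toℚᵘ (i / n) ℚᵘ.+ toℚᵘ (j / n)       ≈⟨ ℚᵘ.≃-sym (toℚᵘ-homo-+ (i / n) (j / n)) ⟩
  toℚᵘ (i / n + j / n)                 ∎)
  where
  open SetoidReasoning ℚᵘ.≃-setoid
  eq : (i ℤ.+ j) ℤ.* + (n ℕ.* n) ≡ (i ℤ.* + n ℤ.+ j ℤ.* + n) ℤ.* + n
  eq = trans (cong ((i ℤ.+ j) ℤ.*_) (ℤ.pos-* n n)) (arith i j (+ n))
    where
    arith : ∀ i j n → (i ℤ.+ j) ℤ.* (n ℤ.* n) ≡ (i ℤ.* n ℤ.+ j ℤ.* n) ℤ.* n
    arith = ℤ-Solver.solve-∀

/-* : ∀ i j m n .{{_ : ℕ.NonZero m}} .{{_ : ℕ.NonZero n}} →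
      ((i ℤ.* j) / (m ℕ.* n)) {{ℕ.m*n≢0 m n}} ≡ i / m * (j / n)
/-* i j m@(suc _) n@(suc _) = toℚᵘ-injective (begin
  toℚᵘ ((i ℤ.* j) / (m ℕ.* n))      ≈⟨ toℚᵘ-/ (i ℤ.* j) (m ℕ.* n) ⟩
  (i ℚᵘ./ m) ℚᵘ.* (j ℚᵘ./ n)        ≈⟨ ℚᵘ.≃-sym (ℚᵘ.*-cong (toℚᵘ-/ i m) (toℚᵘ-/ j n)) ⟩
  toℚᵘ (i / m) ℚᵘ.* toℚᵘ (j / n)    ≈⟨ ℚᵘ.≃-sym (toℚᵘ-homo-* (i / m) (j / n)) ⟩
  toℚᵘ (i / m * (j / n))            ∎)
  where open SetoidReasoning ℚᵘ.≃-setoid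

n/n≡1 : ∀ n .{{_ : ℕ.NonZero n}} → + n / n ≡ 1ℚ
n/n≡1 n@(suc _) = toℚᵘ-injective (ℚᵘ.≃-trans (toℚᵘ-/ (+ n) n)
  (ℚᵘ.*≡* (trans (ℤ.*-identityʳ (+ n)) (sym (ℤ.*-identityˡ (+ n))))))

/-complement : ∀ a b n .{{_ : ℕ.NonZero n}} → a ℕ.+ b ≡ n → + b / n ≡ 1ℚ - + a / n
/-complement a b n a+b≡n = begin
  + b / n                          ≡⟨ y≡[x+y]-x (+ a / n) (+ b / n) ⟩
  (+ a / n + + b / n) - + a / n    ≡⟨ cong (_- + a / n) (sym (/-+ (+ a) (+ b) n)) ⟩
  (+ a ℤ.+ + b) / n - + a / n      ≡⟨ cong (λ i → i / n - + a / n) (sym (ℤ.pos-+ a b)) ⟩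
  + (a ℕ.+ b) / n - + a / n        ≡⟨ cong (λ i → + i / n - + a / n) a+b≡n ⟩
  + n / n - + a / n                ≡⟨ cong (_- + a / n) (n/n≡1 n) ⟩
  1ℚ - + a / n                     ∎
  where
  open ≡-Reasoning
  y≡[x+y]-x : ∀ x y → y ≡ (x + y) - x
  y≡[x+y]-x = solve-∀ ℚ-ring

/-sum-of-cubes : ∀ a b n .{{_ : ℕ.NonZero n}} →
                 (+ (a ℕ.* a ℕ.* a ℕ.+ b ℕ.* b ℕ.* b) / (n ℕ.* n ℕ.* n)) {{ℕ.m*n≢0 (n ℕ.* n) n {{ℕ.m*n≢0 n n}}}}
                   ≡ (+ a / n) * (+ a / n) * (+ a / n) + (+ b / n) * (+ b / n) * (+ b / n)
/-sum-of-cubes a b n = begin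
  + (a ℕ.* a ℕ.* a ℕ.+ b ℕ.* b ℕ.* b) / n³
    ≡⟨ cong (_/ n³) (trans (ℤ.pos-+ (a ℕ.* a ℕ.* a) _) (cong₂ ℤ._+_ (pos-cube a) (pos-cube b))) ⟩
  (+ a ℤ.* + a ℤ.* + a ℤ.+ + b ℤ.* + b ℤ.* + b) / n³
    ≡⟨ /-+ (+ a ℤ.* + a ℤ.* + a) _ n³ ⟩
  (+ a ℤ.* + a ℤ.* + a) / n³ + (+ b ℤ.* + b ℤ.* + b) / n³
    ≡⟨ cong₂ _+_ (cube-/ (+ a)) (cube-/ (+ b)) ⟩
  (+ a / n) * (+ a / n) * (+ a / n) + (+ b / n) * (+ b / n) * (+ b / n) ∎
  where
  open ≡-Reasoning
  n³ : ℕ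
  n³ = n ℕ.* n ℕ.* n
  instance
    n³-nonZero : ℕ.NonZero n³
    n³-nonZero = ℕ.m*n≢0 (n ℕ.* n) n {{ℕ.m*n≢0 n n}}
  pos-cube : ∀ a → + (a ℕ.* a ℕ.* a) ≡ + a ℤ.* + a ℤ.* + a
  pos-cube a = trans (ℤ.pos-* (a ℕ.* a) a) (cong (ℤ._* + a) (ℤ.pos-* a a))
  cube-/ : ∀ i → (i ℤ.* i ℤ.* i) / n³ ≡ (i / n) * (i / n) * (i / n)
  cube-/ i = trans (/-* (i ℤ.* i) i (n ℕ.* n) n {{ℕ.m*n≢0 n n}}) (cong (_* (i / n)) (/-* i i n n))

p*↧p≡↥p : ∀ p → p * ι (↧ₙ p) ≡ fromℤ (↥ p)
p*↧p≡↥p p@(mkℚ i d _) = toℚᵘ-injective (begin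
  toℚᵘ (p * ι (suc d))                     ≈⟨ toℚᵘ-homo-* p (ι (suc d)) ⟩
  ℚᵘ.mkℚᵘ i d ℚᵘ.* ℚᵘ.mkℚᵘ (+ suc d) 0      ≈⟨ ℚᵘ.*≡* eq ⟩
  toℚᵘ (fromℤ i)                            ∎)
  where
  open SetoidReasoning ℚᵘ.≃-setoid
  eq : (i ℤ.* + suc d) ℤ.* + 1 ≡ i ℤ.* + (suc d ℕ.* 1)
  eq = trans (ℤ.*-identityʳ _) (cong (λ n → i ℤ.* + n) (sym (ℕ.*-identityʳ (suc d))))

≤-by-difference : ∀ {p q} r → q - p ≡ r → 0ℚ ≤ r → p ≤ q
≤-by-difference {p} {q} r q-p≡r 0≤r = begin
  p             ≡⟨ sym (+-identityʳ p) ⟩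
  p + 0ℚ        ≤⟨ +-monoʳ-≤ p 0≤r ⟩
  p + r         ≡⟨ cong (λ t → p + t) (sym q-p≡r) ⟩
  p + (q - p)   ≡⟨ p+[q-p]≡q p q ⟩
  q             ∎
  where
  open ≤-Reasoning
  p+[q-p]≡q : ∀ p q → p + (q - p) ≡ q
  p+[q-p]≡q = solve-∀ ℚ-ring

p≤q⇒0≤q-p : ∀ {p q} → p ≤ q → 0ℚ ≤ q - p
p≤q⇒0≤q-p {p} {q} p≤q = begin
  0ℚ      ≡⟨ sym (+-inverseʳ p) ⟩
  p - p   ≤⟨ +-monoˡ-≤ (- p) p≤q ⟩
  q - p   ∎
  where open ≤-Reasoning

0≤+ : ∀ {p q} → 0ℚ ≤ p → 0ℚ ≤ q → 0ℚ ≤ p + q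
0≤+ {p} {q} 0≤p 0≤q = nonNegative⁻¹ (p + q) {{nonNeg+nonNeg⇒nonNeg p {{nonNegative 0≤p}} q {{nonNegative 0≤q}}}}

0≤* : ∀ {p q} → 0ℚ ≤ p → 0ℚ ≤ q → 0ℚ ≤ p * q
0≤* {p} {q} 0≤p 0≤q = nonNegative⁻¹ (p * q) {{nonNeg*nonNeg⇒nonNeg p {{nonNegative 0≤p}} q {{nonNegative 0≤q}}}}

0≤p*p : ∀ p → 0ℚ ≤ p * p
0≤p*p p with ≤-total 0ℚ p
... | inj₁ 0≤p = 0≤* 0≤p 0≤p
... | inj₂ p≤0 = nonNegative⁻¹ (p * p) {{nonPos*nonPos⇒nonPos p {{nonPositive p≤0}} p {{nonPositive p≤0}}}}

∣p∣*∣p∣≡p*p : ∀ p → ∣ p ∣ * ∣ p ∣ ≡ p * p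
∣p∣*∣p∣≡p*p p = trans (sym (∣p*q∣≡∣p∣*∣q∣ p p)) (0≤p⇒∣p∣≡p (0≤p*p p))

p*p≤1⇒p≤1 : ∀ p → p * p ≤ 1ℚ → p ≤ 1ℚ
p*p≤1⇒p≤1 p p²≤1 with p ≤? 1ℚ
... | yes p≤1 = p≤1
... | no  p≰1 = contradiction (<-≤-trans 1<p² p²≤1) (<-irrefl refl)
  where
  1<p : 1ℚ < p
  1<p = ≰⇒> p≰1
  instance
    p-pos : Positive p
    p-pos = positive (<-trans (positive⁻¹ 1ℚ) 1<p)
  1<p² : 1ℚ < p * p
  1<p² = begin-strict
    1ℚ       <⟨ 1<p ⟩
    p        ≡⟨ sym (*-identityʳ p) ⟩
    p * 1ℚ   <⟨ *-monoʳ-<-pos p 1<p ⟩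
    p * p    ∎
    where open ≤-Reasoning

Null : (ℕ → ℚ) → Set
Null x = ∀ ε → 0ℚ < ε → Σ ℕ λ K → ∀ k → K ℕ.≤ k → ∣ x k ∣ ≤ ε

-- With D the denominator of ε, ε D ≥ 1, and k ≥ D² gives (|x_k| D)² ≤ x_k² (m + k) ≤ 1.
square-bound⇒null : (x : ℕ → ℚ) (m : ℚ) → 0ℚ ≤ m → (∀ k → x k * x k * (m + ι k) ≤ 1ℚ) → Null x
square-bound⇒null x m 0≤m bound ε@(mkℚ (+ suc n) d _) _ = suc d ℕ.* suc d , eventually
  where
  D : ℚ
  D = ι (suc d)
  1≤εD : 1ℚ ≤ ε * D
  1≤εD = begin
    1ℚ          ≤⟨ ι-mono-≤ (ℕ.s≤s ℕ.z≤n) ⟩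
    ι (suc n)   ≡⟨ sym (p*↧p≡↥p ε) ⟩
    ε * D       ∎
    where open ≤-Reasoning
  eventually : ∀ k → suc d ℕ.* suc d ℕ.≤ k → ∣ x k ∣ ≤ ε
  eventually k d²≤k = *-cancelʳ-≤-pos D (≤-trans (p*p≤1⇒p≤1 (∣ x k ∣ * D) ∣x∣²D²≤1) 1≤εD)
    where
    open ≤-Reasoning
    rearrange : ∀ a b → (a * b) * (a * b) ≡ a * a * (b * b)
    rearrange = solve-∀ ℚ-ring
    ∣x∣²D²≤1 : (∣ x k ∣ * D) * (∣ x k ∣ * D) ≤ 1ℚ
    ∣x∣²D²≤1 = begin
      (∣ x k ∣ * D) * (∣ x k ∣ * D)   ≡⟨ rearrange ∣ x k ∣ D ⟩
      ∣ x k ∣ * ∣ x k ∣ * (D * D)     ≡⟨ cong₂ _*_ (∣p∣*∣p∣≡p*p (x k)) (sym (ι-* (suc d) (suc d))) ⟩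
      x k * x k * ι (suc d ℕ.* suc d) ≤⟨ *-monoˡ-≤-nonNeg (x k * x k) {{nonNegative (0≤p*p (x k))}} (begin
        ι (suc d ℕ.* suc d)             ≤⟨ ι-mono-≤ d²≤k ⟩
        ι k                             ≡⟨ sym (+-identityˡ (ι k)) ⟩
        0ℚ + ι k                        ≤⟨ +-monoˡ-≤ (ι k) 0≤m ⟩
        m + ι k                         ∎) ⟩
      x k * x k * (m + ι k)           ≤⟨ bound k ⟩
      1ℚ                              ∎
square-bound⇒null x m 0≤m bound ε@(mkℚ (+ 0) _ _) 0<ε = ⊥-elim (ℤ.Positive.pos (positive 0<ε))
square-bound⇒null x m 0≤m bound ε@(mkℚ ℤ.-[1+ _ ] _ _) 0<ε = ⊥-elim (ℤ.Positive.pos (positive 0<ε))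

reciprocal-step : ∀ {w w′ m} → 0ℚ ≤ w → 1ℚ ≤ m → w * m ≤ 1ℚ → w′ ≤ w - w * w → w′ * (m + 1ℚ) ≤ 1ℚ
reciprocal-step {w} {w′} {m} 0≤w 1≤m wm≤1 w′≤w-w² = ≤-by-difference _ (identity w w′ m)
  (0≤+ (0≤+ (0≤* (p≤q⇒0≤q-p w′≤w-w²) 0≤m+1) (0≤* (p≤q⇒0≤q-p wm≤1) (p≤q⇒0≤q-p w≤1))) (0≤p*p w))
  where
  0≤m+1 : 0ℚ ≤ m + 1ℚ
  0≤m+1 = 0≤+ (≤-trans (nonNegative⁻¹ _) 1≤m) (nonNegative⁻¹ _)
  w≤1 : w ≤ 1ℚ
  w≤1 = begin
    w        ≡⟨ sym (*-identityʳ w) ⟩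
    w * 1ℚ   ≤⟨ *-monoˡ-≤-nonNeg w {{nonNegative 0≤w}} 1≤m ⟩
    w * m    ≤⟨ wm≤1 ⟩
    1ℚ       ∎
    where open ≤-Reasoning
  identity : ∀ w w′ m → 1ℚ - w′ * (m + 1ℚ) ≡ (w - w * w - w′) * (m + 1ℚ) + (1ℚ - w * m) * (1ℚ - w) + w * w
  identity = solve-∀ ℚ-ring

reciprocal-decay : (w : ℕ → ℚ) (m : ℚ) → 1ℚ ≤ m → (∀ k → 0ℚ ≤ w k) →
                   (∀ k → w (suc k) ≤ w k - w k * w k) → w 0 * m ≤ 1ℚ →
                   ∀ k → w k * (m + ι k) ≤ 1ℚ
reciprocal-decay w m 1≤m 0≤w decay w₀m≤1 ℕ.zero = subst (λ t → w 0 * t ≤ 1ℚ) (sym (+-identityʳ m)) w₀m≤1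
reciprocal-decay w m 1≤m 0≤w decay w₀m≤1 (suc k) =
  subst (λ t → w (suc k) * t ≤ 1ℚ) m+ι[1+k]
    (reciprocal-step (0≤w k) 1≤m+k (reciprocal-decay w m 1≤m 0≤w decay w₀m≤1 k) (decay k))
  where
  1≤m+k : 1ℚ ≤ m + ι k
  1≤m+k = ≤-trans 1≤m (≤-trans (≤-reflexive (sym (+-identityʳ m))) (+-monoʳ-≤ m (0≤ι k)))
  rearrange : ∀ p q → p + q + 1ℚ ≡ p + (1ℚ + q)
  rearrange = solve-∀ ℚ-ring
  m+ι[1+k] : m + ι k + 1ℚ ≡ m + ι (suc k)
  m+ι[1+k] = trans (rearrange m (ι k)) (cong (λ t → m + t) (sym (ι-suc k)))

^-3* : ∀ a m → a ℕ.^ (3 ℕ.* m) ≡ a ℕ.^ m ℕ.* a ℕ.^ m ℕ.* a ℕ.^ m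
^-3* a m = begin
  a ℕ.^ (3 ℕ.* m)                          ≡⟨ cong (a ℕ.^_) (ℕ.*-comm 3 m) ⟩
  a ℕ.^ (m ℕ.* 3)                          ≡⟨ sym (ℕ.^-*-assoc a m 3) ⟩
  (a ℕ.^ m) ℕ.^ 3                          ≡⟨ cube (a ℕ.^ m) ⟩
  a ℕ.^ m ℕ.* a ℕ.^ m ℕ.* a ℕ.^ m          ∎
  where
  open ≡-Reasoning
  cube : ∀ x → x ℕ.^ 3 ≡ x ℕ.* x ℕ.* x
  cube x = trans (cong (x ℕ.*_) (cong (x ℕ.*_) (ℕ.*-identityʳ x))) (sym (ℕ.*-assoc x x x))

density-true : ∀ k → density k true ≡ 1ℚ - density k false
density-true k = /-complement (count k false) (count k true) (2 ℕ.^ 3 ℕ.^ suc k) {{ℕ.m^n≢0 2 (3 ℕ.^ suc k)}}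
                               (count-false+count-true k)

density-suc : ∀ k → let p = density k false in
              density (suc k) false ≡ p * p * p + (1ℚ - p) * (1ℚ - p) * (1ℚ - p)
density-suc k = begin
  density (suc k) false
    ≡⟨ /-cong (cong +_ (count-suc k)) (^-3* 2 (3 ℕ.^ suc k)) ⟩
  + (a ℕ.* a ℕ.* a ℕ.+ b ℕ.* b ℕ.* b) / (N ℕ.* N ℕ.* N)
    ≡⟨ /-sum-of-cubes a b N ⟩
  p * p * p + (+ b / N) * (+ b / N) * (+ b / N)
    ≡⟨ cong (λ q → p * p * p + q * q * q) (density-true k) ⟩
  p * p * p + (1ℚ - p) * (1ℚ - p) * (1ℚ - p) ∎
  where
  open ≡-Reasoning
  N a b : ℕ
  N = 2 ℕ.^ 3 ℕ.^ suc k
  a = count k false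
  b = count k true
  p : ℚ
  p = density k false
  instance
    N-nonZero : ℕ.NonZero N
    N-nonZero = ℕ.m^n≢0 2 (3 ℕ.^ suc k)
    N′-nonZero : ℕ.NonZero (2 ℕ.^ 3 ℕ.^ suc (suc k))
    N′-nonZero = ℕ.m^n≢0 2 (3 ℕ.^ suc (suc k))
    N³-nonZero : ℕ.NonZero (N ℕ.* N ℕ.* N)
    N³-nonZero = ℕ.m*n≢0 (N ℕ.* N) N {{ℕ.m*n≢0 N N}}

F : ℚ → ℚ
F x = + 3 / 1 * (x * x) - x

W : ℚ → ℚ
W x = + 2 / 1 * (x * x) * (1ℚ - + 3 / 1 * x)

lo hi : ℚ
lo = - (+ 1 / 12)
hi = + 5 / 48

-- The ring solver does not unfold definitions, so the certificates below spell out F, W, lo and hi.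
F-≥-lo : ∀ x → lo ≤ F x
F-≥-lo x = ≤-by-difference _ (identity x) (0≤* (nonNegative⁻¹ _) (0≤p*p (x - + 1 / 6)))
  where
  identity : ∀ x → (+ 3 / 1 * (x * x) - x) - - (+ 1 / 12) ≡ + 3 / 1 * ((x - + 1 / 6) * (x - + 1 / 6))
  identity = solve-∀ ℚ-ring

F-≤-hi : ∀ {x} → lo ≤ x → x ≤ hi → F x ≤ hi
F-≤-hi {x} lo≤x x≤hi = ≤-by-difference _ (identity x)
  (0≤* (nonNegative⁻¹ _) (0≤* (p≤q⇒0≤q-p lo≤x) (0≤+ (p≤q⇒0≤q-p x≤hi) (nonNegative⁻¹ _))))
  where
  identity : ∀ x → + 5 / 48 - (+ 3 / 1 * (x * x) - x)
                   ≡ + 3 / 1 * ((x - - (+ 1 / 12)) * ((+ 5 / 48 - x) + + 5 / 16))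
  identity = solve-∀ ℚ-ring

W-nonneg : ∀ {x} → x ≤ hi → 0ℚ ≤ W x
W-nonneg {x} x≤hi = ≤-by-difference _ (identity x)
  (0≤* (0≤p*p x) (0≤+ (0≤* (nonNegative⁻¹ _) (p≤q⇒0≤q-p x≤hi)) (nonNegative⁻¹ _)))
  where
  identity : ∀ x → + 2 / 1 * (x * x) * (1ℚ - + 3 / 1 * x) - 0ℚ
                   ≡ x * x * (+ 6 / 1 * (+ 5 / 48 - x) + + 11 / 8)
  identity = solve-∀ ℚ-ring

x*x≤W : ∀ {x} → x ≤ hi → x * x ≤ W x
x*x≤W {x} x≤hi = ≤-by-difference _ (identity x)
  (0≤* (0≤p*p x) (0≤+ (0≤* (nonNegative⁻¹ _) (p≤q⇒0≤q-p x≤hi)) (nonNegative⁻¹ _)))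
  where
  identity : ∀ x → + 2 / 1 * (x * x) * (1ℚ - + 3 / 1 * x) - x * x
                   ≡ x * x * (+ 6 / 1 * (+ 5 / 48 - x) + + 3 / 8)
  identity = solve-∀ ℚ-ring

W∘F≤W-W² : ∀ {x} → x ≤ hi → W (F x) ≤ W x - W x * W x
W∘F≤W-W² {x} x≤hi = ≤-by-difference _ (identity x)
  (0≤* (0≤p*p (x * x)) (0≤+ (0≤+ (0≤* (nonNegative⁻¹ _) (0≤p*p x)) (0≤* (nonNegative⁻¹ _) (p≤q⇒0≤q-p x≤hi))) (nonNegative⁻¹ _)))
  where
  identity : ∀ x → let w = + 2 / 1 * (x * x) * (1ℚ - + 3 / 1 * x); y = + 3 / 1 * (x * x) - x in
             (w - w * w) - + 2 / 1 * (y * y) * (1ℚ - + 3 / 1 * y)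
               ≡ (x * x) * (x * x) * (+ 126 / 1 * (x * x) + + 138 / 1 * (+ 5 / 48 - x) + + 423 / 24)
  identity = solve-∀ ℚ-ring

e : ℕ → ℚ
e k = density k false - + 1 / 3

e-zero : e 0 ≡ lo
e-zero = refl

e-suc : ∀ k → e (suc k) ≡ F (e k)
e-suc k = trans (cong (_- + 1 / 3) (density-suc k)) (identity (density k false))
  where
  identity : ∀ p → (p * p * p + (1ℚ - p) * (1ℚ - p) * (1ℚ - p)) - + 1 / 3
                   ≡ + 3 / 1 * ((p - + 1 / 3) * (p - + 1 / 3)) - (p - + 1 / 3)
  identity = solve-∀ ℚ-ring

e-window : ∀ k → lo ≤ e k × e k ≤ hi
e-window ℕ.zero    = subst (λ x → lo ≤ x × x ≤ hi) (sym e-zero) (≤-refl , from-yes (lo ≤? hi))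
e-window (suc k)   = subst (λ x → lo ≤ x × x ≤ hi) (sym (e-suc k))
                       (F-≥-lo (e k) , F-≤-hi (proj₁ (e-window k)) (proj₂ (e-window k)))

W∘e-bound : ∀ k → W (e k) * (ι 50 + ι k) ≤ 1ℚ
W∘e-bound = reciprocal-decay (W ∘ e) (ι 50) (ι-mono-≤ (ℕ.s≤s ℕ.z≤n))
  (λ k → W-nonneg (proj₂ (e-window k)))
  (λ k → subst (λ x → W x ≤ W (e k) - W (e k) * W (e k)) (sym (e-suc k)) (W∘F≤W-W² (proj₂ (e-window k))))
  (subst (λ x → W x * ι 50 ≤ 1ℚ) (sym e-zero) (from-yes (W lo * ι 50 ≤? 1ℚ)))

e-null : Null e
e-null = square-bound⇒null e (ι 50) (0≤ι 50) λ k →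
  ≤-trans (*-monoʳ-≤-nonNeg (ι 50 + ι k) {{nonNegative (0≤+ (0≤ι 50) (0≤ι k))}} (x*x≤W (proj₂ (e-window k))))
          (W∘e-bound k)

∣density-true-2/3∣≡∣e∣ : ∀ k → ∣ density k true - + 2 / 3 ∣ ≡ ∣ e k ∣
∣density-true-2/3∣≡∣e∣ k = begin
  ∣ density k true - + 2 / 3 ∣            ≡⟨ cong (λ q → ∣ q - + 2 / 3 ∣) (density-true k) ⟩
  ∣ (1ℚ - density k false) - + 2 / 3 ∣    ≡⟨ cong ∣_∣ (identity (density k false)) ⟩
  ∣ - e k ∣                               ≡⟨ ∣-p∣≡∣p∣ (e k) ⟩
  ∣ e k ∣                                 ∎
  where
  open ≡-Reasoning
  identity : ∀ p → (1ℚ - p) - + 2 / 3 ≡ - (p - + 1 / 3)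
  identity = solve-∀ ℚ-ring

proposition7p4 : (ε : ℚ) → 0ℚ < ε →
    Σ ℕ (λ K → (k : ℕ) → K Data.Nat.≤ k →
      (∣ density k false - (+ 1) / 3 ∣ ≤ ε) × (∣ density k true - (+ 2) / 3 ∣ ≤ ε))
proposition7p4 ε 0<ε =
  let K , ∣e∣≤ε = e-null ε 0<ε in
  K , λ k K≤k → ∣e∣≤ε k K≤k , subst (_≤ ε) (sym (∣density-true-2/3∣≡∣e∣ k)) (∣e∣≤ε k K≤k)
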